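{- Let $k\ge0$ and let $G$ be a connected $k$-metamour-regular graph with $n$ vertices, and let $M$ be the metamour graph of $G$. Then the following are equivalent: (a) $M=\overline{G}$; (b) $G$ has diameter $2$ or $G=K_n$; (c) $G=\overline{M_1}\nabla\cdots\nabla\overline{M_t}$ where $\{M_1,\dots,M_t\}$ is the set of connected components of $M$; (d) $G$ is $(n-1-k)$-regular.
   Context: All graphs are finite, simple and have at least one vertex; isomorphic graphs are regarded as equal. A vertex $v$ is a metamour of a vertex $w$ in $G$ if their distance in $G$ equals $2$. The metamour graph of $G$ is the graph on $V(G)$ with an edge between $v$ and $w$ whenever $v$ is a metamour of $w$ in $G$. $G$ is $k$-metamour-regular if every vertex has exactly $k$ metamours. $\overline{H}$ denotes the complement of $H$. For graphs $G_1,G_2$ with disjoint vertex sets, the join $G_1\nabla G_2$ has vertex set $V(G_1)\cup V(G_2)$ and edge set $E(G_1)\cup E(G_2)\cup\{\{g_1,g_2\}: g_1\in V(G_1), g_2\in V(G_2)\}$; it is associative and commutative (for $t=1$ the join expression is just $\overline{M_1}$). -}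

module Defs where

open import Data.Nat using (ℕ; zero; suc; _≤_; _<_)
open import Data.Fin using (Fin)
open import Data.Fin.Subset using (Subset; _∈_; ∣_∣)
open import Data.Bool using (Bool; T)
open import Data.Product using (Σ; Σ-syntax; _×_)
open import Data.Sum using (_⊎_)
open import Relation.Nullary using (¬_)
open import Relation.Binary.PropositionalEquality using (_≡_; _≢_)
open import Relation.Binary.Construct.Closure.ReflexiveTransitive using (Star)
open import Function.Bundles using (_⇔_)

record Graph (n : ℕ) : Set where
  field
    adj    : Fin n → Fin n → Bool
    sym    : ∀ u v → adj u v ≡ adj v u
    irrefl : ∀ u → ¬ T (adj u u)

module _ {n : ℕ} (G : Graph n) where
  open Graph G

  E : Fin n → Fin n → Set
  E u v = T (adj u v)

  data Walk : Fin n → Fin n → ℕ → Set where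
    here : ∀ {u} → Walk u u 0
    step : ∀ {u w v ℓ} → E u w → Walk w v ℓ → Walk u v (suc ℓ)

  Dist : Fin n → Fin n → ℕ → Set
  Dist u v d = Walk u v d × (∀ ℓ → ℓ < d → ¬ Walk u v ℓ)

  Connected : Set
  Connected = ∀ u v → Σ[ ℓ ∈ ℕ ] Walk u v ℓ

  -- v is a metamour of u (distance 2); this is the edge relation of the metamour graph M
  Metamour : Fin n → Fin n → Set
  Metamour u v = Dist u v 2

  CoE : Fin n → Fin n → Set
  CoE u v = (u ≢ v) × ¬ E u v

  HasCount : (Fin n → Set) → ℕ → Set
  HasCount P k = Σ[ S ∈ Subset n ] (∣ S ∣ ≡ k × (∀ w → (w ∈ S) ⇔ P w))

  MetamourRegular : ℕ → Set
  MetamourRegular k = ∀ v → HasCount (Metamour v) k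

  Regular : ℕ → Set
  Regular r = ∀ v → HasCount (E v) r

  HasDiameter : ℕ → Set
  HasDiameter d = (∀ u v → Σ[ e ∈ ℕ ] (e ≤ d × Dist u v e))
                × Σ[ u ∈ Fin n ] Σ[ v ∈ Fin n ] Dist u v d

  Complete : Set
  Complete = ∀ u v → u ≢ v → E u v

  -- u and v lie in the same connected component of the metamour graph M
  SameComp : Fin n → Fin n → Set
  SameComp = Star Metamour

  -- edge relation of the join  complement(M_1) ∇ … ∇ complement(M_t)  on V(G),
  -- M_1,…,M_t the connected components of M
  JoinE : Fin n → Fin n → Set
  JoinE u v = (¬ SameComp u v) ⊎ (SameComp u v × u ≢ v × ¬ Metamour u v)

{-# OPTIONS --safe #-}
module Submission where

open import Defs
open import Data.Nat using (ℕ; _≤_; _∸_)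
open import Data.Fin using (Fin)
open import Data.Product using (_×_)
open import Data.Sum using (_⊎_)
open import Function.Bundles using (_⇔_)

open import Data.Bool using (T?)
open import Data.Empty using (⊥-elim)
open import Data.Fin using (zero; suc; _≟_)
open import Data.Fin.Properties using (any?)
open import Data.Fin.Subset using (Subset; _∈_; _∉_; ∣_∣; ∁; _-_; _⊆_; inside; outside)
open import Data.Fin.Subset.Properties
  using (_∈?_; ∣∁p∣≡n∸∣p∣; p─⊥≡p; p─q⊆p; p⊆q⇒∣p∣≤∣q∣; p⊂q⇒∣p∣<∣q∣)
open import Data.Fin.Subset.Properties using (x∈∁p⇒x∉p; x∉p⇒x∈∁p; x∈p∧x≢y⇒x∈p-y)
open import Data.Nat using (zero; suc; _+_; z≤n; s≤s)
open import Data.Nat.Properties using (∸-+-assoc; +-comm; m∸n≤m; m∸[m∸n]≡n; ≤-trans; <-irrefl)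
open import Data.Product using (Σ-syntax; ∃-syntax; _,_; proj₁; proj₂)
open import Data.Sum using (inj₁; inj₂)
open import Data.Unit using (⊤; tt)
open import Data.Vec using (_∷_; here; there)
open import Function using (_∘_)
open import Function.Bundles using (mk⇔; Equivalence)
open import Function.Properties.Equivalence using () renaming (sym to ⇔-sym; trans to ⇔-trans)
open import Level using (0ℓ)
open import Relation.Binary.Core using (Rel)
open import Relation.Binary.Definitions using (Decidable)
open import Relation.Binary.Construct.Closure.ReflexiveTransitive using (Star; ε; _◅_; _◅◅_)
open import Relation.Binary.PropositionalEquality using (_≡_; _≢_; refl; sym; trans; cong; subst; subst₂; module ≡-Reasoning)
open import Relation.Nullary using (¬_; yes; no)
open import Relation.Nullary.Decidable using (_×-dec_; _⊎-dec_; ¬?; map′; decidable-stable)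

open Equivalence using (to; from)

-- Metamours are distinct and non-adjacent, so (a) says that every non-adjacent pair u ≠ v
-- has a common neighbour, i.e. that all distances are at most 2; this gives (a) ⇔ (b).
-- Read on edges, (a) says that u ~ v exactly when u ≠ v and u, v are not metamours, and
-- the join in (c) has precisely this edge relation, whatever the components of M are.
-- For (d): the n − 1 vertices other than v split into neighbours, the k metamours and the
-- remaining non-neighbours, so v has n − 1 − k neighbours iff there are no vertices of the
-- third kind.

[m∸n]∸o≡[m∸o]∸n : ∀ m n o → m ∸ n ∸ o ≡ m ∸ o ∸ n
[m∸n]∸o≡[m∸o]∸n m n o = begin
  m ∸ n ∸ o    ≡⟨ ∸-+-assoc m n o ⟩
  m ∸ (n + o)  ≡⟨ cong (m ∸_) (+-comm n o) ⟩
  m ∸ (o + n)  ≡⟨ ∸-+-assoc m o n ⟨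
  m ∸ o ∸ n    ∎
  where open ≡-Reasoning

n≤m∸[m∸n]⇒m∸[m∸n]≡n : ∀ {m n} → n ≤ m ∸ (m ∸ n) → m ∸ (m ∸ n) ≡ n
n≤m∸[m∸n]⇒m∸[m∸n]≡n {m} {n} n≤ = m∸[m∸n]≡n (≤-trans n≤ (m∸n≤m m (m ∸ n)))

x∉p-x : ∀ {n} {p : Subset n} x → x ∉ p - x
x∉p-x {p = _ ∷ _} zero ()
x∉p-x {p = _ ∷ _} (suc x) (there x∈p-x) = x∉p-x x x∈p-x

x∈p⇒∣p∣≡1+∣p-x∣ : ∀ {n} {p : Subset n} {x} → x ∈ p → ∣ p ∣ ≡ suc ∣ p - x ∣
x∈p⇒∣p∣≡1+∣p-x∣ {p = inside ∷ p} here = cong suc (cong ∣_∣ (sym (p─⊥≡p p)))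
x∈p⇒∣p∣≡1+∣p-x∣ {p = inside ∷ _} (there x∈p) = cong suc (x∈p⇒∣p∣≡1+∣p-x∣ x∈p)
x∈p⇒∣p∣≡1+∣p-x∣ {p = outside ∷ _} (there x∈p) = x∈p⇒∣p∣≡1+∣p-x∣ x∈p

-- Reachability on Fin (suc m) reduces to reachability on Fin m for the relation "one R-step,
-- possibly through zero": an R-path is cut at its visits to zero, and FromSuc, FromZero
-- describe what the pieces look like according to where the path starts and ends.
module EliminateZero {m : ℕ} (R : Rel (Fin (suc m)) 0ℓ) where

  Bypass : Rel (Fin m) 0ℓ
  Bypass x y = R (suc x) (suc y) ⊎ (R (suc x) zero × R zero (suc y))

  Bypass? : Decidable R → Decidable Bypass
  Bypass? R? x y = R? (suc x) (suc y) ⊎-dec (R? (suc x) zero ×-dec R? zero (suc y))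

  bypass⇒star : ∀ {x y} → Star Bypass x y → Star R (suc x) (suc y)
  bypass⇒star ε = ε
  bypass⇒star (inj₁ r ◅ p) = r ◅ bypass⇒star p
  bypass⇒star (inj₂ (r , r′) ◅ p) = r ◅ r′ ◅ bypass⇒star p

  FromSuc : Fin m → Fin (suc m) → Set
  FromSuc x zero = ∃[ z ] (Star Bypass x z × R (suc z) zero)
  FromSuc x (suc y) = Star Bypass x y

  FromZero : Fin (suc m) → Set
  FromZero zero = ⊤
  FromZero (suc y) = ∃[ z ] (R zero (suc z) × Star Bypass z y)

  fromSuc : ∀ {x b} → Star R (suc x) b → FromSuc x b
  fromZero : ∀ {b} → Star R zero b → FromZero b

  fromSuc ε = ε
  fromSuc {x} {b} (_◅_ {j = zero} r p) = enter b (fromZero p)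
    where
    enter : ∀ b → FromZero b → FromSuc x b
    enter zero _ = x , ε , r
    enter (suc _) (_ , r′ , q) = inj₂ (r , r′) ◅ q
  fromSuc {x} {b} (_◅_ {j = suc z} r p) = extend b (fromSuc p)
    where
    extend : ∀ b → FromSuc z b → FromSuc x b
    extend zero (z′ , q , r′) = z′ , inj₁ r ◅ q , r′
    extend (suc _) q = inj₁ r ◅ q

  fromZero ε = tt
  fromZero (_◅_ {j = zero} _ p) = fromZero p
  fromZero {b} (_◅_ {j = suc z} r p) = leave b (fromSuc p)
    where
    leave : ∀ b → FromSuc z b → FromZero b
    leave zero _ = tt
    leave (suc _) q = z , r , q

star? : ∀ {m} {R : Rel (Fin m) 0ℓ} → Decidable R → Decidable (Star R)
star? {zero} _ ()
star? {suc m} {R} R? = dec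
  where
  open EliminateZero R
  bypass* : Decidable (Star Bypass)
  bypass* = star? (Bypass? R?)
  dec : Decidable (Star R)
  dec zero zero = yes ε
  dec zero (suc y) = map′ (λ (z , r , p) → r ◅ bypass⇒star p) fromZero
    (any? (λ z → R? zero (suc z) ×-dec bypass* z y))
  dec (suc x) zero = map′ (λ (z , p , r) → bypass⇒star p ◅◅ (r ◅ ε)) fromSuc
    (any? (λ z → bypass* x z ×-dec R? (suc z) zero))
  dec (suc x) (suc y) = map′ bypass⇒star fromSuc (bypass* x y)

module _ {n : ℕ} (G : Graph n) where
  open Graph G using (adj; irrefl)

  private
    variable
      u v w : Fin n
      a : ℕ
      P Q : Fin n → Set

  -- HasCount does not depend on the graph: these are facts about predicates on Fin n.
  HasCount-cong : (∀ w → P w ⇔ Q w) → HasCount G P a → HasCount G Q a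
  HasCount-cong P⇔Q (S , ∣S∣ , S⇔P) = S , ∣S∣ , λ w → ⇔-trans (S⇔P w) (P⇔Q w)

  HasCount-¬ : HasCount G P a → HasCount G (λ w → ¬ P w) (n ∸ a)
  HasCount-¬ (S , ∣S∣ , S⇔P) = ∁ S , trans (∣∁p∣≡n∸∣p∣ S) (cong (n ∸_) ∣S∣) , λ w →
    mk⇔ (λ w∈∁S → x∈∁p⇒x∉p w∈∁S ∘ from (S⇔P w)) (λ ¬Pw → x∉p⇒x∈∁p (¬Pw ∘ to (S⇔P w)))

  HasCount-remove : P v → HasCount G P a → HasCount G (λ w → v ≢ w × P w) (a ∸ 1)
  HasCount-remove {v = v} Pv (S , ∣S∣ , S⇔P) =
    S - v , cong (_∸ 1) (trans (sym (x∈p⇒∣p∣≡1+∣p-x∣ v∈S)) ∣S∣) , λ w →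
      mk⇔ (λ w∈S-v → (λ { refl → x∉p-x v w∈S-v }) , to (S⇔P w) (p─q⊆p S _ w∈S-v))
          (λ (v≢w , Pw) → x∈p∧x≢y⇒x∈p-y (from (S⇔P w) Pw) (v≢w ∘ sym))
    where
    v∈S : v ∈ S
    v∈S = from (S⇔P v) Pv

  HasCount-mono : ∀ {b} → (∀ {w} → P w → Q w) → HasCount G P a → HasCount G Q b → a ≤ b
  HasCount-mono P⇒Q (S , ∣S∣ , S⇔P) (T , ∣T∣ , T⇔Q) =
    subst₂ _≤_ ∣S∣ ∣T∣ (p⊆q⇒∣p∣≤∣q∣ (λ {w} → from (T⇔Q w) ∘ P⇒Q ∘ to (S⇔P w)))

  HasCount-⊆-same⇒⊇ : (∀ {w} → P w → Q w) → HasCount G P a → HasCount G Q a → Q w → P w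
  HasCount-⊆-same⇒⊇ {w = w} P⇒Q (S , ∣S∣ , S⇔P) (T , ∣T∣ , T⇔Q) Qw with w ∈? S
  ... | yes w∈S = to (S⇔P w) w∈S
  ... | no w∉S =
    ⊥-elim (<-irrefl (trans ∣S∣ (sym ∣T∣)) (p⊂q⇒∣p∣<∣q∣ (S⊆T , w , from (T⇔Q w) Qw , w∉S)))
    where
    S⊆T : S ⊆ T
    S⊆T {x} = from (T⇔Q x) ∘ P⇒Q ∘ to (S⇔P x)

  E? : Decidable (E G)
  E? u v = T? (adj u v)

  CoE? : Decidable (CoE G)
  CoE? u v = ¬? (u ≟ v) ×-dec ¬? (E? u v)

  E⇒≢ : E G u v → u ≢ v
  E⇒≢ {u} e refl = irrefl u e

  Metamour⇒CoE : Metamour G u v → CoE G u v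
  Metamour⇒CoE (_ , shorter) =
    (λ { refl → shorter 0 (s≤s z≤n) here }) , λ e → shorter 1 (s≤s (s≤s z≤n)) (step e here)

  CoE∧path⇒Metamour : CoE G u v → E G u w → E G w v → Metamour G u v
  CoE∧path⇒Metamour (u≢v , ¬e) e e′ = step e (step e′ here) , λ
    { zero _ here → u≢v refl
    ; (suc zero) _ (step e here) → ¬e e
    ; (suc (suc _)) (s≤s (s≤s ())) _ }

  CoE∧Dist≤2⇒Metamour : ∀ {d} → CoE G u v → Dist G u v d → d ≤ 2 → Metamour G u v
  CoE∧Dist≤2⇒Metamour (u≢v , _) (here , _) _ = ⊥-elim (u≢v refl)
  CoE∧Dist≤2⇒Metamour (_ , ¬e) (step e here , _) _ = ⊥-elim (¬e e)
  CoE∧Dist≤2⇒Metamour _ dist@(step _ (step _ here) , _) _ = dist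
  CoE∧Dist≤2⇒Metamour _ (step _ (step _ (step _ _)) , _) (s≤s (s≤s ()))

  Metamour? : Decidable (Metamour G)
  Metamour? u v with CoE? u v | any? (λ w → E? u w ×-dec E? w v)
  ... | no ¬co | _ = no (¬co ∘ Metamour⇒CoE)
  ... | yes co | yes (_ , e , e′) = yes (CoE∧path⇒Metamour co e e′)
  ... | yes _ | no ¬path = no λ { (step e (step e′ here) , _) → ¬path (_ , e , e′) }

  SameComp? : Decidable (SameComp G)
  SameComp? = star? Metamour?

  JoinE⇔≢×¬Metamour : JoinE G u v ⇔ (u ≢ v × ¬ Metamour G u v)
  JoinE⇔≢×¬Metamour {u} {v} = mk⇔ to′ from′
    where
    to′ : JoinE G u v → u ≢ v × ¬ Metamour G u v
    to′ (inj₁ ¬same) = (λ { refl → ¬same ε }) , λ m → ¬same (m ◅ ε)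
    to′ (inj₂ (_ , u≢v , ¬m)) = u≢v , ¬m
    from′ : u ≢ v × ¬ Metamour G u v → JoinE G u v
    from′ (u≢v , ¬m) with SameComp? u v
    ... | yes same = inj₂ (same , u≢v , ¬m)
    ... | no ¬same = inj₁ ¬same

  MetamourGraphIsComplement : Set
  MetamourGraphIsComplement = ∀ u v → Metamour G u v ⇔ CoE G u v

  CoE⇒Metamour⇒complement : (∀ u v → CoE G u v → Metamour G u v) → MetamourGraphIsComplement
  CoE⇒Metamour⇒complement co⇒m u v = mk⇔ Metamour⇒CoE (co⇒m u v)

  complement⇒diameter≤2 : MetamourGraphIsComplement → ∀ u v → Σ[ d ∈ ℕ ] (d ≤ 2 × Dist G u v d)
  complement⇒diameter≤2 c u v with u ≟ v | E? u v
  ... | yes refl | _ = 0 , z≤n , here , λ _ ()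
  ... | no u≢v | yes e = 1 , s≤s z≤n , step e here , λ { zero _ here → u≢v refl ; (suc _) (s≤s ()) _ }
  ... | no u≢v | no ¬e = 2 , s≤s (s≤s z≤n) , from (c u v) (u≢v , ¬e)

  complement⇔diameter2⊎complete : MetamourGraphIsComplement ⇔ (HasDiameter G 2 ⊎ Complete G)
  complement⇔diameter2⊎complete = mk⇔ to′ from′
    where
    to′ : MetamourGraphIsComplement → HasDiameter G 2 ⊎ Complete G
    to′ c with any? (λ u → any? (λ v → CoE? u v))
    ... | yes (u , v , co) = inj₁ (complement⇒diameter≤2 c , u , v , from (c u v) co)
    ... | no ¬co = inj₂ λ u v u≢v → decidable-stable (E? u v) (λ ¬e → ¬co (u , v , u≢v , ¬e))
    from′ : HasDiameter G 2 ⊎ Complete G → MetamourGraphIsComplement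
    from′ (inj₁ (diameter≤2 , _)) = CoE⇒Metamour⇒complement λ u v co →
      let (_ , d≤2 , dist) = diameter≤2 u v in CoE∧Dist≤2⇒Metamour co dist d≤2
    from′ (inj₂ complete) = CoE⇒Metamour⇒complement λ u v (u≢v , ¬e) → ⊥-elim (¬e (complete u v u≢v))

  complement⇔E⇔≢×¬Metamour : MetamourGraphIsComplement ⇔ (∀ u v → E G u v ⇔ (u ≢ v × ¬ Metamour G u v))
  complement⇔E⇔≢×¬Metamour = mk⇔ to′ from′
    where
    to′ : MetamourGraphIsComplement → ∀ u v → E G u v ⇔ (u ≢ v × ¬ Metamour G u v)
    to′ c u v = mk⇔ (λ e → E⇒≢ e , λ m → Metamour⇒CoE m .proj₂ e)
      (λ (u≢v , ¬m) → decidable-stable (E? u v) (λ ¬e → ¬m (from (c u v) (u≢v , ¬e))))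
    from′ : (∀ u v → E G u v ⇔ (u ≢ v × ¬ Metamour G u v)) → MetamourGraphIsComplement
    from′ h = CoE⇒Metamour⇒complement λ u v (u≢v , ¬e) →
      decidable-stable (Metamour? u v) (λ ¬m → ¬e (from (h u v) (u≢v , ¬m)))

  complement⇔join : MetamourGraphIsComplement ⇔ (∀ u v → E G u v ⇔ JoinE G u v)
  complement⇔join = mk⇔
    (λ c u v → ⇔-trans (to complement⇔E⇔≢×¬Metamour c u v) (⇔-sym JoinE⇔≢×¬Metamour))
    (λ h → from complement⇔E⇔≢×¬Metamour λ u v → ⇔-trans (h u v) JoinE⇔≢×¬Metamour)

  module _ {k : ℕ} (metamour-regular : MetamourRegular G k) where

    complement⇒regular : MetamourGraphIsComplement → Regular G (n ∸ 1 ∸ k)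
    complement⇒regular c v = subst (HasCount G (E G v)) ([m∸n]∸o≡[m∸o]∸n n k 1)
      (HasCount-cong (λ w → ⇔-sym (to complement⇔E⇔≢×¬Metamour c v w))
        (HasCount-remove (λ m → Metamour⇒CoE m .proj₁ refl) (HasCount-¬ (metamour-regular v))))

    -- A co-edge count of n − 1 − (n − 1 − k) can only be k, because the k metamours are co-edges.
    regular⇒complement : Regular G (n ∸ 1 ∸ k) → MetamourGraphIsComplement
    regular⇒complement regular = CoE⇒Metamour⇒complement λ v w →
      HasCount-⊆-same⇒⊇ Metamour⇒CoE (metamour-regular v) (CoE-count v)
      where
      CoE-count : ∀ v → HasCount G (CoE G v) k
      CoE-count v = subst (HasCount G (CoE G v)) (n≤m∸[m∸n]⇒m∸[m∸n]≡n k≤) count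
        where
        count : HasCount G (CoE G v) (n ∸ 1 ∸ (n ∸ 1 ∸ k))
        count = subst (HasCount G (CoE G v)) ([m∸n]∸o≡[m∸o]∸n n (n ∸ 1 ∸ k) 1)
          (HasCount-remove (irrefl v) (HasCount-¬ (regular v)))
        k≤ : k ≤ n ∸ 1 ∸ (n ∸ 1 ∸ k)
        k≤ = HasCount-mono Metamour⇒CoE (metamour-regular v) count

proposition2p13 : (n k : ℕ) → 1 ≤ n → (G : Graph n) → Connected G → MetamourRegular G k →
    let A = (∀ u v → Metamour G u v ⇔ CoE G u v)
        B = HasDiameter G 2 ⊎ Complete G
        C = (∀ u v → E G u v ⇔ JoinE G u v)
        D = Regular G (n ∸ 1 ∸ k)
    in (A ⇔ B) × (A ⇔ C) × (A ⇔ D)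
proposition2p13 n k _ G _ metamour-regular =
  complement⇔diameter2⊎complete G ,
  complement⇔join G ,
  mk⇔ (complement⇒regular G metamour-regular) (regular⇒complement G metamour-regular)
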